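{- As $\mathbb{L}$-species, $\mathrm{Cay}(212) = \mathrm{Alt}'$. Equivalently, for every $n\ge 0$ the number of Cayley permutations of length $n$ avoiding the pattern $212$ equals the number of even permutations of an $(n+1)$-element set.
   Context: A Cayley permutation of length $n$ is a word $w=w_1\cdots w_n$ of positive integers such that $\{w_1,\dots,w_n\}=[k]=\{1,\dots,k\}$ for some $k\le n$ (the empty word is the unique one of length $0$). A word $w$ contains a Cayley permutation $p=p_1\cdots p_k$ if some subsequence $w_{i_1}\cdots w_{i_k}$ with $i_1<\cdots<i_k$ is order isomorphic to $p$ (for all $a,b$: $w_{i_a}<w_{i_b}\iff p_a<p_b$ and $w_{i_a}=w_{i_b}\iff p_a=p_b$); otherwise $w$ avoids $p$. An $\mathbb{L}$-species $F$ assigns to each finite totally ordered set $\ell$ a finite set $F[\ell]$, functorially with respect to order-preserving bijections; two $\mathbb{L}$-species are isomorphic (written $F=G$) iff $|F[n]|=|G[n]|$ for all $n$. $\mathrm{Cay}(p)$ is the $\mathbb{L}$-species whose structures on $[n]$ are the $p$-avoiding Cayley permutations of length $n$. $\mathrm{Alt}$ is the species of even permutations. The derivative is $F'[\ell]=F[1\oplus\ell]$, where $1\oplus\ell$ is $\ell$ with a new minimum element adjoined. -}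

module Defs where

open import Data.Bool.Base using (Bool; true; false; not; _∧_; T; if_then_else_)
open import Data.Nat.Base using (ℕ; zero; suc; _+_; _≡ᵇ_; _<ᵇ_; _⊔_; _∸_)
open import Data.List.Base using (List; []; _∷_; map; _++_; length; foldr; upTo; filter)
open import Data.Bool.ListAction using (all; any)
open import Data.Nat.ListAction using (sum)
open import Data.Product using (Σ; _×_; _,_)
open import Function.Bundles using (_↔_)

-- Words are lists of naturals; Boolean predicates are used throughout so that
-- the subtypes  Σ (List ℕ) (λ w → T (P w))  are genuine subsets
-- (T b is proof-irrelevant), and "same cardinality" is expressed by a bijection.

_==ᴮ_ : Bool → Bool → Bool
true  ==ᴮ b = b
false ==ᴮ b = not b

_∈ᵇ_ : ℕ → List ℕ → Bool
x ∈ᵇ w = any (λ y → x ≡ᵇ y) w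

maxW : List ℕ → ℕ
maxW = foldr _⊔_ 0

-- A word w of positive integers is a Cayley permutation iff its set of
-- values is {1,…,k} for some k (necessarily k = max w).
isCayley : List ℕ → Bool
isCayley w = all (λ x → not (x ≡ᵇ 0)) w
           ∧ all (λ j → suc j ∈ᵇ w) (upTo (maxW w))

subsequences : List ℕ → List (List ℕ)
subsequences []       = [] ∷ []
subsequences (x ∷ xs) = let s = subsequences xs in map (x ∷_) s ++ s

zipL : List ℕ → List ℕ → List (ℕ × ℕ)
zipL (x ∷ xs) (y ∷ ys) = (x , y) ∷ zipL xs ys
zipL _ _ = []

orderIso : List ℕ → List ℕ → Bool
orderIso u p = (length u ≡ᵇ length p) ∧
  all (λ { (x , y) → all (λ { (x′ , y′) →
        ((x <ᵇ x′) ==ᴮ (y <ᵇ y′)) ∧ ((x ≡ᵇ x′) ==ᴮ (y ≡ᵇ y′)) }) zs }) zs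
  where zs = zipL u p

contains : List ℕ → List ℕ → Bool
contains p w = any (λ u → orderIso u p) (subsequences w)

avoids : List ℕ → List ℕ → Bool
avoids p w = not (contains p w)

CayAvoid : List ℕ → ℕ → Set
CayAvoid p n = Σ (List ℕ) λ w → T ((length w ≡ᵇ n) ∧ isCayley w ∧ avoids p w)

-- Permutations of the m-element set {0,…,m-1} in one-line notation:
-- words of length m in which every element of {0,…,m-1} occurs.
isPerm : ℕ → List ℕ → Bool
isPerm m w = (length w ≡ᵇ m) ∧ all (λ j → j ∈ᵇ w) (upTo m)

inversions : List ℕ → ℕ
inversions []       = 0
inversions (x ∷ xs) = sum (map (λ y → if y <ᵇ x then 1 else 0) xs) + inversions xs

isEven : ℕ → Bool
isEven zero          = true
isEven (suc zero)    = false
isEven (suc (suc n)) = isEven n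

Alt : ℕ → Set
Alt m = Σ (List ℕ) λ w → T (isPerm m w ∧ isEven (inversions w))

-- the derivative of an L-species on [n] is its value on 1 ⊕ [n], of size n+1
Alt′ : ℕ → Set
Alt′ n = Alt (suc n)

p212 : List ℕ
p212 = 2 ∷ 1 ∷ 2 ∷ []

module Submission where

-- A 212-avoiding Cayley permutation of length n + 1 with largest letter K has all its copies of K
-- in one contiguous block: an entry y < K between two copies of K would be an occurrence of 212.
-- Deleting the block leaves a 212-avoiding Cayley permutation of some length i ≤ n, and the
-- deleted block is determined by its position (i + 1 choices) and the length n + 1 − i, so
-- c(n + 1) = Σ_{i ≤ n} (i + 1) c(i).  Deleting the largest letter m from a permutation of
-- {0, …, m} leaves a permutation, and putting m back at position p creates m − p inversions;
-- hence from two letters on half of the permutations are even, and a(n) = |Alt(n + 1)| satisfies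
-- a(n + 1) = (n + 2) a(n) = Σ_{i ≤ n} (i + 1) a(i).  So both sides are in bijection with Fin (a n).

open import Data.Bool.Base using (Bool; true; false; not; _∧_; _∨_; T; if_then_else_)
open import Data.Bool.ListAction using (any; or; all)
open import Data.Bool.Properties
  using (∨-assoc; ∨-zeroʳ; ∧-zeroʳ; ∧-identityʳ; ∨-conicalˡ; ∨-conicalʳ; T-∧; T-not-≡; T?; T-irrelevant)
open import Data.Empty using (⊥-elim)
open import Data.Fin.Base as Fin using (Fin; toℕ; fromℕ<; fromℕ; inject₁)
open import Data.Fin.Properties using (toℕ-fromℕ<; toℕ-injective; toℕ<n; toℕ-inject₁; toℕ-fromℕ; +↔⊎; *↔×)
open import Data.List.Base using (List; []; _∷_; map; _++_; null; take; drop; replicate; length; upTo)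
open import Data.List.Membership.Propositional using (_∈_; _∉_)
open import Data.List.Properties using (map-∘; map-cong)
open import Data.List.Relation.Unary.All as All using (All; []; _∷_)
open import Data.List.Relation.Unary.All.Properties using (all⁺; all⁻; applyUpTo⁺₁; applyUpTo⁻)
open import Data.List.Relation.Unary.Any as Any using (here; there)
open import Data.List.Relation.Unary.Any.Properties using (any⁺; any⁻)
open import Data.Nat.Base using (ℕ; zero; suc; pred; _+_; _∸_; _*_; _≤_; _<_; z≤n; s≤s; _≡ᵇ_; _<ᵇ_; >-nonZero)
open import Data.Nat.Induction using (<-rec)
import Data.Nat.ListAction as List
open import Data.Nat.Properties
open import Algebra.Properties.Monoid.Sum +-0-monoid using (sum; sum-syntax; sum-cong-≗; sum-init-last)
open import Data.Product.Base using (Σ; _×_; _,_; proj₁; proj₂)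
open import Data.Product.Function.NonDependent.Propositional using (_×-↔_)
open import Data.Sum.Base using (_⊎_; inj₁; inj₂; map₂)
open import Data.Sum.Function.Propositional using (_⊎-↔_)
open import Data.Unit.Base using (tt)
open import Defs
open import Function.Base using (_∘_; case_of_; id)
open import Function.Bundles using (_⇔_; mk⇔; Equivalence; _↔_; mk↔ₛ′)
open import Function.Properties.Inverse using (↔-refl; ↔-trans; ↔-sym)
import Function.Related.Propositional as Related
open import Relation.Binary.PropositionalEquality
open import Relation.Nullary.Decidable using (yes; no; dec-true; dec-false)
open import Relation.Nullary.Negation using (¬_; contradiction)

T-⇔⇒≡ : ∀ {a b} → T a ⇔ T b → a ≡ b
T-⇔⇒≡ {false} {false} _   = refl
T-⇔⇒≡ {false} {true}  a⇔b = ⊥-elim (Equivalence.from a⇔b tt)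
T-⇔⇒≡ {true}  {false} a⇔b = ⊥-elim (Equivalence.to a⇔b tt)
T-⇔⇒≡ {true}  {true}  _   = refl

¬T⇒≡false : ∀ {b} → ¬ T b → b ≡ false
¬T⇒≡false {b} = dec-false (T? b)

T-∧ˡ : ∀ a {b} → T (a ∧ b) → T a
T-∧ˡ a = proj₁ ∘ Equivalence.to (T-∧ {a})

T-∧ʳ : ∀ a {b} → T (a ∧ b) → T b
T-∧ʳ a = proj₂ ∘ Equivalence.to (T-∧ {a})

==ᴮ-true : ∀ {b} → T (b ==ᴮ true) → T b
==ᴮ-true {true} _ = tt

+-suc-∸ : ∀ {m n} → m ≤ n → m + suc (n ∸ m) ≡ suc n
+-suc-∸ {m} m≤n = trans (+-suc m _) (cong suc (m+[n∸m]≡n m≤n))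

+≡suc⇒≡suc∸ : ∀ L c n → L + c ≡ suc n → 0 < c → c ≡ suc (n ∸ L)
+≡suc⇒≡suc∸ L (suc c) n eq _ =
  cong suc (trans (sym (m+n∸m≡n L c)) (cong (_∸ L) (suc-injective (trans (sym (+-suc L c)) eq))))

subtype-≡ : ∀ {P : List ℕ → Bool} {x y : Σ (List ℕ) (T ∘ P)} → proj₁ x ≡ proj₁ y → x ≡ y
subtype-≡ {x = w , t} {y = .w , t′} refl = cong (w ,_) (T-irrelevant t t′)

∈ᵇ⇒∈ : ∀ {x} w → T (x ∈ᵇ w) → x ∈ w
∈ᵇ⇒∈ {x} w = Any.map (≡ᵇ⇒≡ x _) ∘ any⁻ _ w

∈⇒∈ᵇ : ∀ {x w} → x ∈ w → T (x ∈ᵇ w)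
∈⇒∈ᵇ {x} = any⁺ _ ∘ Any.map (≡⇒≡ᵇ x _)

∉⇒∈ᵇ≡false : ∀ {x} w → x ∉ w → (x ∈ᵇ w) ≡ false
∉⇒∈ᵇ≡false w x∉w = ¬T⇒≡false (x∉w ∘ ∈ᵇ⇒∈ w)

module _ {A : Set} where

  any-++ : ∀ (f : A → Bool) xs ys → any f (xs ++ ys) ≡ (any f xs ∨ any f ys)
  any-++ f []       ys = refl
  any-++ f (x ∷ xs) ys = trans (cong (f x ∨_) (any-++ f xs ys)) (sym (∨-assoc (f x) _ _))

  any-map : ∀ {B : Set} (f : B → Bool) (g : A → B) xs → any f (map g xs) ≡ any (f ∘ g) xs
  any-map f g xs = cong or (sym (map-∘ xs))

  any-cong : ∀ {f g : A → Bool} → (∀ x → f x ≡ g x) → ∀ xs → any f xs ≡ any g xs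
  any-cong f≗g xs = cong or (map-cong f≗g xs)

  any-∧ : ∀ c (f : A → Bool) xs → any (λ x → c ∧ f x) xs ≡ (c ∧ any f xs)
  any-∧ true  f xs = refl
  any-∧ false f xs = any-false xs
    where
    any-false : ∀ xs → any (λ _ → false) xs ≡ false
    any-false []       = refl
    any-false (_ ∷ xs) = any-false xs

-- Occurrences of 212

orderIso-212 : ∀ x y z → orderIso (x ∷ y ∷ z ∷ []) p212 ≡ ((y <ᵇ x) ∧ (x ≡ᵇ z))
orderIso-212 x y z = T-⇔⇒≡ (mk⇔ forth back)
  where
  entry : ℕ → ℕ → ℕ → ℕ → Bool
  entry a p a′ p′ = ((a <ᵇ a′) ==ᴮ (p <ᵇ p′)) ∧ ((a ≡ᵇ a′) ==ᴮ (p ≡ᵇ p′))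
  row : ℕ → ℕ → Bool
  row a p = entry a p x 2 ∧ (entry a p y 1 ∧ (entry a p z 2 ∧ true))

  -- the entries (y, x) and (x, z) of the comparison table already force y < x = z
  forth : T (orderIso (x ∷ y ∷ z ∷ []) p212) → T ((y <ᵇ x) ∧ (x ≡ᵇ z))
  forth t = Equivalence.from (T-∧ {y <ᵇ x})
      (==ᴮ-true {y <ᵇ x} (T-∧ˡ ((y <ᵇ x) ==ᴮ true) yx) , ==ᴮ-true {x ≡ᵇ z} (T-∧ʳ ((x <ᵇ z) ==ᴮ false) xz))
    where
    rowx = T-∧ˡ (row x 2) t
    yx = T-∧ˡ (entry y 1 x 2) (T-∧ˡ (row y 1) (T-∧ʳ (row x 2) t))
    xz = T-∧ˡ (entry x 2 z 2) (T-∧ʳ (entry x 2 y 1) (T-∧ʳ (entry x 2 x 2) rowx))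

  -- does (m ≟ n) and does (m <? n) compute to m ≡ᵇ n and m <ᵇ n, so dec-true/dec-false decide
  -- each comparison of the table once z = x
  back : T ((y <ᵇ x) ∧ (x ≡ᵇ z)) → T (orderIso (x ∷ y ∷ z ∷ []) p212)
  back t with ≡ᵇ⇒≡ x z (T-∧ʳ (y <ᵇ x) t) | <ᵇ⇒< y x (T-∧ˡ (y <ᵇ x) t)
  ... | refl | y<x
    rewrite dec-false (x <? x) (n≮n x) | dec-true (x ≟ x) refl
          | dec-false (y <? y) (n≮n y) | dec-true (y ≟ y) refl
          | dec-true (y <? x) y<x | dec-false (x <? y) (<⇒≯ y<x)
          | dec-false (y ≟ x) (<⇒≢ y<x) | dec-false (x ≟ y) (<⇒≢ y<x ∘ sym) = tt

returnsAfterDip : ℕ → List ℕ → Bool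
returnsAfterDip x []       = false
returnsAfterDip x (y ∷ ys) = ((y <ᵇ x) ∧ (x ∈ᵇ ys)) ∨ returnsAfterDip x ys

has212 : List ℕ → Bool
has212 []       = false
has212 (x ∷ xs) = returnsAfterDip x xs ∨ has212 xs

any-subsequences-∷ : ∀ (f : List ℕ → Bool) x xs →
  any f (subsequences (x ∷ xs)) ≡ (any (f ∘ (x ∷_)) (subsequences xs) ∨ any f (subsequences xs))
any-subsequences-∷ f x xs = trans (any-++ f (map (x ∷_) s) s) (cong (_∨ any f s) (any-map f (x ∷_) s))
  where s = subsequences xs

isSingleton : ℕ → List ℕ → Bool
isSingleton x []      = false
isSingleton x (z ∷ u) = (x ≡ᵇ z) ∧ null u

orderIso-212-∷∷ : ∀ x y u → orderIso (x ∷ y ∷ u) p212 ≡ ((y <ᵇ x) ∧ isSingleton x u)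
orderIso-212-∷∷ x y []           = sym (∧-zeroʳ _)
orderIso-212-∷∷ x y (z ∷ [])     = trans (orderIso-212 x y z) (cong ((y <ᵇ x) ∧_) (sym (∧-identityʳ _)))
orderIso-212-∷∷ x y (z ∷ _ ∷ _) = trans (sym (∧-zeroʳ _)) (cong ((y <ᵇ x) ∧_) (sym (∧-zeroʳ _)))

any-null-subsequences : ∀ xs → any null (subsequences xs) ≡ true
any-null-subsequences []       = refl
any-null-subsequences (x ∷ xs) =
  trans (any-subsequences-∷ null x xs) (trans (cong (b ∨_) (any-null-subsequences xs)) (∨-zeroʳ b))
  where b = any (null ∘ (x ∷_)) (subsequences xs)

any-isSingleton-subsequences : ∀ x xs → any (isSingleton x) (subsequences xs) ≡ (x ∈ᵇ xs)
any-isSingleton-subsequences x []       = refl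
any-isSingleton-subsequences x (z ∷ zs) = begin
  any (isSingleton x) (subsequences (z ∷ zs))
    ≡⟨ any-subsequences-∷ (isSingleton x) z zs ⟩
  any (λ u → (x ≡ᵇ z) ∧ null u) (subsequences zs) ∨ any (isSingleton x) (subsequences zs)
    ≡⟨ cong₂ _∨_ (any-∧ (x ≡ᵇ z) null (subsequences zs)) (any-isSingleton-subsequences x zs) ⟩
  ((x ≡ᵇ z) ∧ any null (subsequences zs)) ∨ (x ∈ᵇ zs)
    ≡⟨ cong (λ b → ((x ≡ᵇ z) ∧ b) ∨ (x ∈ᵇ zs)) (any-null-subsequences zs) ⟩
  ((x ≡ᵇ z) ∧ true) ∨ (x ∈ᵇ zs)
    ≡⟨ cong (_∨ (x ∈ᵇ zs)) (∧-identityʳ _) ⟩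
  (x ≡ᵇ z) ∨ (x ∈ᵇ zs) ∎
  where open ≡-Reasoning

any-orderIso-212 : ∀ x ys → any (λ u → orderIso (x ∷ u) p212) (subsequences ys) ≡ returnsAfterDip x ys
any-orderIso-212 x []       = refl
any-orderIso-212 x (y ∷ ys) = begin
  any (λ u → orderIso (x ∷ u) p212) (subsequences (y ∷ ys))
    ≡⟨ any-subsequences-∷ (λ u → orderIso (x ∷ u) p212) y ys ⟩
  any (λ u → orderIso (x ∷ y ∷ u) p212) s ∨ any (λ u → orderIso (x ∷ u) p212) s
    ≡⟨ cong₂ _∨_ (any-cong (orderIso-212-∷∷ x y) s) (any-orderIso-212 x ys) ⟩
  any (λ u → (y <ᵇ x) ∧ isSingleton x u) s ∨ returnsAfterDip x ys
    ≡⟨ cong (_∨ returnsAfterDip x ys)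
         (trans (any-∧ (y <ᵇ x) (isSingleton x) s) (cong ((y <ᵇ x) ∧_) (any-isSingleton-subsequences x ys))) ⟩
  ((y <ᵇ x) ∧ (x ∈ᵇ ys)) ∨ returnsAfterDip x ys ∎
  where
  open ≡-Reasoning
  s = subsequences ys

contains-212 : ∀ w → contains p212 w ≡ has212 w
contains-212 []       = refl
contains-212 (x ∷ xs) =
  trans (any-subsequences-∷ (λ u → orderIso u p212) x xs)
        (cong₂ _∨_ (any-orderIso-212 x xs) (contains-212 xs))

-- Deleting and inserting a block of equal letters

removeAll : ℕ → List ℕ → List ℕ
removeAll K []       = []
removeAll K (x ∷ xs) with x ≟ K
... | yes _ = removeAll K xs
... | no  _ = x ∷ removeAll K xs

count : ℕ → List ℕ → ℕ
count K []       = 0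
count K (x ∷ xs) with x ≟ K
... | yes _ = suc (count K xs)
... | no  _ = count K xs

firstIndex : ℕ → List ℕ → ℕ
firstIndex K []       = 0
firstIndex K (x ∷ xs) with x ≟ K
... | yes _ = 0
... | no  _ = suc (firstIndex K xs)

insertBlock : (p c K : ℕ) → List ℕ → List ℕ
insertBlock p c K w = take p w ++ replicate c K ++ drop p w

length-removeAll : ∀ K w → length (removeAll K w) + count K w ≡ length w
length-removeAll K []       = refl
length-removeAll K (x ∷ xs) with x ≟ K
... | yes _ = trans (+-suc _ _) (cong suc (length-removeAll K xs))
... | no  _ = cong suc (length-removeAll K xs)

firstIndex≤length-removeAll : ∀ K w → firstIndex K w ≤ length (removeAll K w)
firstIndex≤length-removeAll K []       = z≤n
firstIndex≤length-removeAll K (x ∷ xs) with x ≟ K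
... | yes _ = z≤n
... | no  _ = s≤s (firstIndex≤length-removeAll K xs)

∈-removeAll⁻ : ∀ {x} K w → x ∈ removeAll K w → x ∈ w × x ≢ K
∈-removeAll⁻ K (y ∷ ys) x∈ with y ≟ K
∈-removeAll⁻ K (y ∷ ys) x∈         | yes _ = let x∈ys , x≢K = ∈-removeAll⁻ K ys x∈ in there x∈ys , x≢K
∈-removeAll⁻ K (y ∷ ys) (here refl) | no y≢K = here refl , y≢K
∈-removeAll⁻ K (y ∷ ys) (there x∈)  | no _ = let x∈ys , x≢K = ∈-removeAll⁻ K ys x∈ in there x∈ys , x≢K

∈-removeAll⁺ : ∀ {x} K w → x ∈ w → x ≢ K → x ∈ removeAll K w
∈-removeAll⁺ K (y ∷ ys) x∈ x≢K with y ≟ K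
∈-removeAll⁺ K (y ∷ ys) (here refl) x≢K | yes y≡K = contradiction y≡K x≢K
∈-removeAll⁺ K (y ∷ ys) (there x∈)  x≢K | yes _   = ∈-removeAll⁺ K ys x∈ x≢K
∈-removeAll⁺ K (y ∷ ys) (here refl) x≢K | no _    = here refl
∈-removeAll⁺ K (y ∷ ys) (there x∈)  x≢K | no _    = there (∈-removeAll⁺ K ys x∈ x≢K)

count>0 : ∀ {K} w → K ∈ w → 0 < count K w
count>0 {K} (y ∷ ys) K∈ with y ≟ K
count>0 (y ∷ ys) K∈          | yes _   = s≤s z≤n
count>0 (y ∷ ys) (here refl) | no y≢K = contradiction refl y≢K
count>0 (y ∷ ys) (there K∈)  | no _    = count>0 ys K∈

count-∉ : ∀ {K} w → K ∉ w → count K w ≡ 0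
count-∉ []       _   = refl
count-∉ {K} (y ∷ ys) K∉ with y ≟ K
... | yes refl = contradiction (here refl) K∉
... | no  _    = count-∉ ys (K∉ ∘ there)

removeAll-count≡0 : ∀ K w → count K w ≡ 0 → removeAll K w ≡ w
removeAll-count≡0 K []       _ = refl
removeAll-count≡0 K (y ∷ ys) c≡0 with y ≟ K
... | no _ = cong (y ∷_) (removeAll-count≡0 K ys c≡0)

removeAll-∉ : ∀ {K} w → K ∉ w → removeAll K w ≡ w
removeAll-∉ {K} w K∉ = removeAll-count≡0 K w (count-∉ w K∉)

removeAll-replicate-++ : ∀ K c w → removeAll K (replicate c K ++ w) ≡ removeAll K w
removeAll-replicate-++ K zero    w = refl
removeAll-replicate-++ K (suc c) w with K ≟ K
... | yes _   = removeAll-replicate-++ K c w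
... | no  K≢K = contradiction refl K≢K

removeAll-insertBlock : ∀ {K} p c w → K ∉ w → removeAll K (insertBlock p c K w) ≡ w
removeAll-insertBlock {K} zero    c w        K∉ = trans (removeAll-replicate-++ K c w) (removeAll-∉ w K∉)
removeAll-insertBlock {K} (suc p) c []       K∉ = removeAll-replicate-++ K c []
removeAll-insertBlock {K} (suc p) c (y ∷ ys) K∉ with y ≟ K
... | yes refl = contradiction (here refl) K∉
... | no  _    = cong (y ∷_) (removeAll-insertBlock p c ys (K∉ ∘ there))

firstIndex-insertBlock : ∀ {K} p c w → K ∉ w → p ≤ length w → firstIndex K (insertBlock p (suc c) K w) ≡ p
firstIndex-insertBlock {K} zero c w K∉ _ with K ≟ K
... | yes _   = refl
... | no  K≢K = contradiction refl K≢K
firstIndex-insertBlock {K} (suc p) c (y ∷ ys) K∉ (s≤s p≤) with y ≟ K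
... | yes refl = contradiction (here refl) K∉
... | no  _    = cong suc (firstIndex-insertBlock p c ys (K∉ ∘ there) p≤)

length-insertBlock : ∀ p c K w → length (insertBlock p c K w) ≡ length w + c
length-insertBlock zero    c K w        = length-replicate-++ c w
  where
  length-replicate-++ : ∀ c w → length (replicate c K ++ w) ≡ length w + c
  length-replicate-++ zero    w = sym (+-identityʳ _)
  length-replicate-++ (suc c) w = trans (cong suc (length-replicate-++ c w)) (sym (+-suc _ c))
length-insertBlock (suc p) c K []       = length-insertBlock zero c K []
length-insertBlock (suc p) c K (y ∷ ys) = cong suc (length-insertBlock p c K ys)

∈-replicate-++⁻ : ∀ {x K : ℕ} {w} c → x ∈ replicate c K ++ w → x ≡ K ⊎ x ∈ w
∈-replicate-++⁻ zero    x∈          = inj₂ x∈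
∈-replicate-++⁻ (suc c) (here refl) = inj₁ refl
∈-replicate-++⁻ (suc c) (there x∈)  = ∈-replicate-++⁻ c x∈

∈-insertBlock⁻ : ∀ {x} p c K w → x ∈ insertBlock p c K w → x ≡ K ⊎ x ∈ w
∈-insertBlock⁻ zero    c K w        x∈          = ∈-replicate-++⁻ c x∈
∈-insertBlock⁻ (suc p) c K []       x∈          = ∈-replicate-++⁻ c x∈
∈-insertBlock⁻ (suc p) c K (y ∷ ys) (here refl) = inj₂ (here refl)
∈-insertBlock⁻ (suc p) c K (y ∷ ys) (there x∈)  = map₂ there (∈-insertBlock⁻ p c K ys x∈)

∈-insertBlock⁺ˡ : ∀ p c K w → K ∈ insertBlock p (suc c) K w
∈-insertBlock⁺ˡ zero    c K w        = here refl
∈-insertBlock⁺ˡ (suc p) c K []       = here refl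
∈-insertBlock⁺ˡ (suc p) c K (y ∷ ys) = there (∈-insertBlock⁺ˡ p c K ys)

∈-insertBlock⁺ʳ : ∀ {x} p c K w → x ∈ w → x ∈ insertBlock p c K w
∈-insertBlock⁺ʳ zero    zero    K w        x∈          = x∈
∈-insertBlock⁺ʳ zero    (suc c) K w        x∈          = there (∈-insertBlock⁺ʳ zero c K w x∈)
∈-insertBlock⁺ʳ (suc p) c       K (y ∷ ys) (here refl) = here refl
∈-insertBlock⁺ʳ (suc p) c       K (y ∷ ys) (there x∈)  = there (∈-insertBlock⁺ʳ p c K ys x∈)

All<⇒∉ : ∀ {K w} → All (_< K) w → K ∉ w
All<⇒∉ {K} all K∈ = n≮n K (All.lookup all K∈)

∈ᵇ-insertBlock : ∀ {x K} p c w → x ≢ K → (x ∈ᵇ insertBlock p c K w) ≡ (x ∈ᵇ w)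
∈ᵇ-insertBlock {x} {K} p c w x≢K = T-⇔⇒≡ (mk⇔ forth back)
  where
  back : T (x ∈ᵇ w) → T (x ∈ᵇ insertBlock p c K w)
  back = ∈⇒∈ᵇ {x} ∘ ∈-insertBlock⁺ʳ p c K w ∘ ∈ᵇ⇒∈ w
  forth : T (x ∈ᵇ insertBlock p c K w) → T (x ∈ᵇ w)
  forth x∈ᵇ = case ∈-insertBlock⁻ p c K w (∈ᵇ⇒∈ (insertBlock p c K w) x∈ᵇ) of λ where
    (inj₁ x≡K) → contradiction x≡K x≢K
    (inj₂ x∈w) → ∈⇒∈ᵇ {x} x∈w

returnsAfterDip-replicate-++ : ∀ {x K} c w → x < K → returnsAfterDip x (replicate c K ++ w) ≡ returnsAfterDip x w
returnsAfterDip-replicate-++ zero w x<K = refl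
returnsAfterDip-replicate-++ {x} {K} (suc c) w x<K
  rewrite dec-false (K <? x) (<⇒≯ x<K) = returnsAfterDip-replicate-++ c w x<K

returnsAfterDip-insertBlock : ∀ {x K} p c w → x < K → returnsAfterDip x (insertBlock p c K w) ≡ returnsAfterDip x w
returnsAfterDip-insertBlock zero    c w        x<K = returnsAfterDip-replicate-++ c w x<K
returnsAfterDip-insertBlock (suc p) c []       x<K = returnsAfterDip-replicate-++ c [] x<K
returnsAfterDip-insertBlock {x} (suc p) c (y ∷ ys) x<K =
  cong₂ (λ b r → ((y <ᵇ x) ∧ b) ∨ r) (∈ᵇ-insertBlock p c ys (<⇒≢ x<K)) (returnsAfterDip-insertBlock p c ys x<K)

returnsAfterDip-top : ∀ {K} c w → All (_< K) w → returnsAfterDip K (replicate c K ++ w) ≡ false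
returnsAfterDip-top {K} (suc c) w all rewrite dec-false (K <? K) (n≮n K) = returnsAfterDip-top c w all
returnsAfterDip-top zero [] [] = refl
returnsAfterDip-top {K} zero (y ∷ ys) (_ ∷ all)
  rewrite ∉⇒∈ᵇ≡false ys (All<⇒∉ all) | ∧-zeroʳ (y <ᵇ K) = returnsAfterDip-top zero ys all

has212-insertBlock : ∀ {K} p c w → All (_< K) w → has212 (insertBlock p c K w) ≡ has212 w
has212-insertBlock zero    c w        all = has212-replicate-++ c
  where
  has212-replicate-++ : ∀ c → has212 (replicate c _ ++ w) ≡ has212 w
  has212-replicate-++ zero    = refl
  has212-replicate-++ (suc c) = cong₂ _∨_ (returnsAfterDip-top c w all) (has212-replicate-++ c)
has212-insertBlock (suc p) c []       all = has212-insertBlock zero c [] all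
has212-insertBlock (suc p) c (y ∷ ys) (y<K ∷ all) =
  cong₂ _∨_ (returnsAfterDip-insertBlock p c ys y<K) (has212-insertBlock p c ys all)

noReturn⇒∉ : ∀ {y K} ys → y < K → returnsAfterDip K (y ∷ ys) ≡ false → K ∉ ys
noReturn⇒∉ {y} {K} ys y<K noReturn K∈ rewrite dec-true (y <? K) y<K =
  subst T (∨-conicalˡ _ _ noReturn) (∈⇒∈ᵇ {K} K∈)

noReturn⇒replicate-removeAll : ∀ {K} w → All (_≤ K) w → returnsAfterDip K w ≡ false →
                               w ≡ replicate (count K w) K ++ removeAll K w
noReturn⇒replicate-removeAll []       []          _ = refl
noReturn⇒replicate-removeAll {K} (y ∷ ys) (y≤K ∷ all) noReturn with y ≟ K
... | yes refl rewrite dec-false (y <? y) (n≮n y) = cong (y ∷_) (noReturn⇒replicate-removeAll ys all noReturn)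
... | no  y≢K = sym (cong₂ (λ c r → replicate c K ++ y ∷ r) (count-∉ ys K∉ys) (removeAll-∉ ys K∉ys))
  where
  K∉ys = noReturn⇒∉ ys (≤∧≢⇒< y≤K y≢K) noReturn

no212⇒insertBlock-removeAll : ∀ {K} w → All (_≤ K) w → has212 w ≡ false →
                              w ≡ insertBlock (firstIndex K w) (count K w) K (removeAll K w)
no212⇒insertBlock-removeAll []       []          _     = refl
no212⇒insertBlock-removeAll {K} (y ∷ ys) (_ ∷ all) no212 with y ≟ K
... | yes refl = cong (y ∷_) (noReturn⇒replicate-removeAll ys all (∨-conicalˡ _ _ no212))
... | no  _    = cong (y ∷_) (no212⇒insertBlock-removeAll ys all (∨-conicalʳ _ _ no212))

count≡1⇒insertBlock-removeAll : ∀ K w → count K w ≡ 1 → w ≡ insertBlock (firstIndex K w) 1 K (removeAll K w)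
count≡1⇒insertBlock-removeAll K (y ∷ ys) once with y ≟ K
... | yes refl = cong (y ∷_) (sym (removeAll-count≡0 y ys (suc-injective once)))
... | no  _    = cong (y ∷_) (count≡1⇒insertBlock-removeAll K ys once)

≤maxW : ∀ {x} w → x ∈ w → x ≤ maxW w
≤maxW (y ∷ ys) (here refl) = m≤m⊔n y (maxW ys)
≤maxW (y ∷ ys) (there x∈)  = ≤-trans (≤maxW ys x∈) (m≤n⊔m y (maxW ys))

≤maxW-all : ∀ w → All (_≤ maxW w) w
≤maxW-all w = All.tabulate (≤maxW w)

maxW≤ : ∀ {M} w → All (_≤ M) w → maxW w ≤ M
maxW≤ []       []          = z≤n
maxW≤ (y ∷ ys) (y≤M ∷ all) = ⊔-lub y≤M (maxW≤ ys all)

maxW∈ : ∀ x xs → maxW (x ∷ xs) ∈ x ∷ xs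
maxW∈ x []       = subst (_∈ x ∷ []) (sym (⊔-identityʳ x)) (here refl)
maxW∈ x (y ∷ ys) with ≤-total x (maxW (y ∷ ys))
... | inj₁ x≤m = subst (_∈ x ∷ y ∷ ys) (sym (m≤n⇒m⊔n≡n x≤m)) (there (maxW∈ y ys))
... | inj₂ m≤x = subst (_∈ x ∷ y ∷ ys) (sym (m≥n⇒m⊔n≡m m≤x)) (here refl)

maxW∈-nonempty : ∀ w → 0 < length w → maxW w ∈ w
maxW∈-nonempty (x ∷ xs) _ = maxW∈ x xs

maxW-unique : ∀ {K} w → K ∈ w → All (_≤ K) w → maxW w ≡ K
maxW-unique w K∈ all = ≤-antisym (maxW≤ w all) (≤maxW w K∈)

removeAll-top : ∀ {K} w → All (_≤ K) w → All (_< K) (removeAll K w)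
removeAll-top {K} w all = All.tabulate λ x∈ →
  let x∈w , x≢K = ∈-removeAll⁻ K w x∈ in ≤∧≢⇒< (All.lookup all x∈w) x≢K

module _ (p c : ℕ) (w : List ℕ) where
  private
    K  = suc (maxW w)
    w⁺ = insertBlock p (suc c) K w

    K∉w : K ∉ w
    K∉w = All<⇒∉ (All.map s≤s (≤maxW-all w))

  maxW-insertBlock : maxW w⁺ ≡ K
  maxW-insertBlock = maxW-unique w⁺ (∈-insertBlock⁺ˡ p c K w) (All.tabulate λ x∈ →
    case ∈-insertBlock⁻ p (suc c) K w x∈ of λ where
      (inj₁ refl) → ≤-refl
      (inj₂ x∈w)  → m≤n⇒m≤1+n (≤maxW w x∈w))

  removeAll-insertBlock-max : removeAll (maxW w⁺) w⁺ ≡ w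
  removeAll-insertBlock-max =
    trans (cong (λ k → removeAll k w⁺) maxW-insertBlock) (removeAll-insertBlock p (suc c) w K∉w)

  firstIndex-insertBlock-max : p ≤ length w → firstIndex (maxW w⁺) w⁺ ≡ p
  firstIndex-insertBlock-max p≤ =
    trans (cong (λ k → firstIndex k w⁺) maxW-insertBlock) (firstIndex-insertBlock p c w K∉w p≤)

-- Cayley permutations avoiding 212

record CayleyWord (w : List ℕ) : Set where
  field
    positive : All (0 <_) w
    complete : ∀ {j} → j < maxW w → suc j ∈ w

isCayley⇒CayleyWord : ∀ w → T (isCayley w) → CayleyWord w
isCayley⇒CayleyWord w t = record
  { positive = All.map (positive _) (all⁺ (λ x → not (x ≡ᵇ 0)) w (T-∧ˡ (all (λ x → not (x ≡ᵇ 0)) w) t))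
  ; complete = ∈ᵇ⇒∈ w ∘ applyUpTo⁻ id (maxW w)
                 (all⁺ (λ j → suc j ∈ᵇ w) (upTo (maxW w)) (T-∧ʳ (all (λ x → not (x ≡ᵇ 0)) w) t))
  }
  where
  positive : ∀ x → T (not (x ≡ᵇ 0)) → 0 < x
  positive (suc x) _ = s≤s z≤n

CayleyWord⇒isCayley : ∀ {w} → CayleyWord w → T (isCayley w)
CayleyWord⇒isCayley {w} cw = Equivalence.from T-∧
  ( all⁻ (λ x → not (x ≡ᵇ 0)) (All.map nonzero positive)
  , all⁻ (λ j → suc j ∈ᵇ w) (applyUpTo⁺₁ id (maxW w) (∈⇒∈ᵇ ∘ complete)) )
  where
  open CayleyWord cw
  nonzero : ∀ {x} → 0 < x → T (not (x ≡ᵇ 0))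
  nonzero (s≤s _) = tt

module _ {w : List ℕ} (cw : CayleyWord w) where
  open CayleyWord cw

  private
    K  = maxW w
    w′ = removeAll K w

  maxW-removeAll-max : maxW w′ ≡ pred K
  maxW-removeAll-max = ≤-antisym upper (lower K refl)
    where
    upper : maxW w′ ≤ pred K
    upper = maxW≤ w′ (All.map <⇒≤pred (removeAll-top w (≤maxW-all w)))
    lower : ∀ k → k ≡ K → pred k ≤ maxW w′
    lower zero          _  = z≤n
    lower (suc zero)    _  = z≤n
    lower (suc (suc j)) eq = ≤maxW w′ (∈-removeAll⁺ K w (complete (subst (j <_) eq (s≤s (n≤1+n j))))
                                                       (λ sj≡K → 1+n≢n (trans eq (sym sj≡K))))

  cayley-removeAll-max : CayleyWord w′
  cayley-removeAll-max = record
    { positive = All.tabulate λ x∈ → All.lookup positive (proj₁ (∈-removeAll⁻ K w x∈))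
    ; complete = λ j<max →
        let sj<K = pred-cancel-< (subst (_ <_) maxW-removeAll-max j<max)
        in ∈-removeAll⁺ K w (complete (<-trans (n<1+n _) sj<K)) (<⇒≢ sj<K)
    }

  cayley-insertBlock : ∀ p c → CayleyWord (insertBlock p (suc c) (suc K) w)
  cayley-insertBlock p c = record
    { positive = All.tabulate λ x∈ → case ∈-insertBlock⁻ p (suc c) (suc K) w x∈ of λ where
        (inj₁ refl) → s≤s z≤n
        (inj₂ x∈w)  → All.lookup positive x∈w
    ; complete = λ {j} j<max → case j ≟ K of λ where
        (yes refl) → ∈-insertBlock⁺ˡ p c (suc K) w
        (no  j≢K)  → ∈-insertBlock⁺ʳ p (suc c) (suc K) w
                       (complete (≤∧≢⇒< (≤-pred (subst (j <_) (maxW-insertBlock p c w) j<max)) j≢K))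
    }

record Cayley212 (n : ℕ) (w : List ℕ) : Set where
  field
    length≡ : length w ≡ n
    cayley  : CayleyWord w
    no212   : has212 w ≡ false

T⇒Cayley212 : ∀ {n} w → T ((length w ≡ᵇ n) ∧ isCayley w ∧ avoids p212 w) → Cayley212 n w
T⇒Cayley212 {n} w t = record
  { length≡ = ≡ᵇ⇒≡ (length w) n (T-∧ˡ (length w ≡ᵇ n) t)
  ; cayley  = isCayley⇒CayleyWord w (T-∧ˡ (isCayley w) rest)
  ; no212   = trans (sym (contains-212 w)) (Equivalence.to T-not-≡ (T-∧ʳ (isCayley w) rest))
  }
  where rest = T-∧ʳ (length w ≡ᵇ n) t

Cayley212⇒T : ∀ {n w} → Cayley212 n w → T ((length w ≡ᵇ n) ∧ isCayley w ∧ avoids p212 w)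
Cayley212⇒T {n} {w} cw = Equivalence.from T-∧
  ( ≡⇒≡ᵇ (length w) n length≡
  , Equivalence.from T-∧ (CayleyWord⇒isCayley cayley , Equivalence.from T-not-≡ (trans (contains-212 w) no212)) )
  where open Cayley212 cw

module _ {n w} (cw : Cayley212 (suc n) w) where
  open Cayley212 cw
  private
    K  = maxW w
    w′ = removeAll K w

    K∈w : K ∈ w
    K∈w = maxW∈-nonempty w (subst (0 <_) (sym length≡) (s≤s z≤n))

    length-removeAll-max : length w′ + count K w ≡ suc n
    length-removeAll-max = trans (length-removeAll K w) length≡

  length-removeAll-max< : length w′ < suc n
  length-removeAll-max< = subst (length w′ <_) length-removeAll-max (m<m+n (length w′) (count>0 w K∈w))

  count-max≡ : count K w ≡ suc (n ∸ length w′)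
  count-max≡ = +≡suc⇒≡suc∸ (length w′) (count K w) n length-removeAll-max (count>0 w K∈w)

  suc-maxW-removeAll-max : suc (maxW w′) ≡ K
  suc-maxW-removeAll-max = trans (cong suc (maxW-removeAll-max cayley)) (suc-pred K {{>-nonZero K>0}})
    where
    K>0 : 0 < K
    K>0 = All.lookup (CayleyWord.positive cayley) K∈w

  insertBlock-removeAll-max : w ≡ insertBlock (firstIndex K w) (count K w) K w′
  insertBlock-removeAll-max = no212⇒insertBlock-removeAll w (≤maxW-all w) no212

  cayley212-removeAll-max : Cayley212 (length w′) w′
  cayley212-removeAll-max = record
    { length≡ = refl
    ; cayley  = cayley-removeAll-max cayley
    ; no212   = begin
        has212 w′                                               ≡⟨ has212-insertBlock p c w′ w′<K ⟨
        has212 (insertBlock p c K w′)                           ≡⟨ cong has212 insertBlock-removeAll-max ⟨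
        has212 w                                                ≡⟨ no212 ⟩
        false                                                   ∎
    }
    where
    open ≡-Reasoning
    p = firstIndex K w
    c = count K w
    w′<K = removeAll-top w (≤maxW-all w)

cayley212-insertBlock : ∀ {i w′} → Cayley212 i w′ → ∀ p c →
                        Cayley212 (i + suc c) (insertBlock p (suc c) (suc (maxW w′)) w′)
cayley212-insertBlock {w′ = w′} cw′ p c = record
  { length≡ = trans (length-insertBlock p (suc c) _ w′) (cong (_+ suc c) length≡)
  ; cayley  = cayley-insertBlock cayley p c
  ; no212   = trans (has212-insertBlock p (suc c) w′ (All.map s≤s (≤maxW-all w′))) no212
  }
  where open Cayley212 cw′

Cay212 : ℕ → Set
Cay212 = CayAvoid p212

toCay212 : ∀ {n w} → Cayley212 n w → Cay212 n
toCay212 {w = w} cw = w , Cayley212⇒T cw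

-- (i, p, w′) stands for the word obtained by inserting into w′ (of length i) a block of
-- n + 1 − i copies of a new largest letter at position p
MaxDecomposition : ℕ → Set
MaxDecomposition n = Σ (Fin (suc n)) λ i → Fin (suc (toℕ i)) × Cay212 (toℕ i)

MaxDecomposition-≡ : ∀ {n} {i i′ : Fin (suc n)} {p : Fin (suc (toℕ i))} {p′ : Fin (suc (toℕ i′))}
                       {x : Cay212 (toℕ i)} {x′ : Cay212 (toℕ i′)} →
                     toℕ i ≡ toℕ i′ → toℕ p ≡ toℕ p′ → proj₁ x ≡ proj₁ x′ →
                     _≡_ {A = MaxDecomposition n} (i , p , x) (i′ , p′ , x′)
MaxDecomposition-≡ {i = i} {p = p} i≡i′ p≡p′ w≡w′ with toℕ-injective i≡i′
... | refl with toℕ-injective p≡p′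
... | refl = cong (λ x → i , p , x) (subtype-≡ w≡w′)

module _ (n : ℕ) where

  private
    module Removal (x : Cay212 (suc n)) where
      w   = proj₁ x
      cw  = T⇒Cayley212 w (proj₂ x)
      K   = maxW w
      w′  = removeAll K w
      i<  = length-removeAll-max< cw
      i   = fromℕ< i<
      p<i : firstIndex K w < suc (toℕ i)
      p<i = s≤s (subst (firstIndex K w ≤_) (sym (toℕ-fromℕ< i<)) (firstIndex≤length-removeAll K w))

  removeMax : Cay212 (suc n) → MaxDecomposition n
  removeMax x =
    i , fromℕ< p<i , toCay212 (subst (λ k → Cayley212 k w′) (sym (toℕ-fromℕ< i<)) (cayley212-removeAll-max cw))
    where open Removal x

  insertMax : MaxDecomposition n → Cay212 (suc n)
  insertMax (i , p , (w′ , t′)) =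
    toCay212 (subst (λ k → Cayley212 k (insertBlock (toℕ p) (suc (n ∸ toℕ i)) (suc (maxW w′)) w′))
                    (+-suc-∸ (≤-pred (toℕ<n i)))
                    (cayley212-insertBlock (T⇒Cayley212 w′ t′) (toℕ p) (n ∸ toℕ i)))

  removeMax-insertMax : ∀ d → removeMax (insertMax d) ≡ d
  removeMax-insertMax (i , p , (w′ , t′)) = MaxDecomposition-≡
    (trans (toℕ-fromℕ< _) (trans (cong length removed) length≡))
    (trans (toℕ-fromℕ< _) (firstIndex-insertBlock-max (toℕ p) c w′ p≤))
    removed
    where
    open Cayley212 (T⇒Cayley212 w′ t′)
    c = n ∸ toℕ i
    removed = removeAll-insertBlock-max (toℕ p) c w′
    p≤ = subst (toℕ p ≤_) (sym length≡) (≤-pred (toℕ<n p))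

  insertMax-removeMax : ∀ x → insertMax (removeMax x) ≡ x
  insertMax-removeMax x = subtype-≡ (begin
    insertBlock (toℕ (fromℕ< p<i)) (suc (n ∸ toℕ i)) (suc (maxW w′)) w′
      ≡⟨ cong₂ (λ p L → insertBlock p (suc (n ∸ L)) (suc (maxW w′)) w′) (toℕ-fromℕ< p<i) (toℕ-fromℕ< i<) ⟩
    insertBlock (firstIndex K w) (suc (n ∸ length w′)) (suc (maxW w′)) w′
      ≡⟨ cong₂ (λ c k → insertBlock (firstIndex K w) c k w′) (sym (count-max≡ cw)) (suc-maxW-removeAll-max cw) ⟩
    insertBlock (firstIndex K w) (count K w) K w′
      ≡⟨ insertBlock-removeAll-max cw ⟨
    w ∎)
    where
    open ≡-Reasoning
    open Removal x

  maxDecomposition : Cay212 (suc n) ↔ MaxDecomposition n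
  maxDecomposition = mk↔ₛ′ removeMax insertMax removeMax-insertMax insertMax-removeMax

-- Permutations by parity

Covers : ℕ → List ℕ → Set
Covers m w = ∀ {j} → j < m → j ∈ w

covers-removeAll : ∀ m w → Covers (suc m) w → Covers m (removeAll m w)
covers-removeAll m w cov j<m = ∈-removeAll⁺ m w (cov (m<n⇒m<1+n j<m)) (<⇒≢ j<m)

covers⇒≤length : ∀ m w → Covers m w → m ≤ length w
covers⇒≤length zero    w cov = z≤n
covers⇒≤length (suc m) w cov = subst (suc m ≤_) (length-removeAll m w) (begin
  suc m                                ≡⟨ +-comm 1 m ⟩
  m + 1                                ≤⟨ +-mono-≤ (covers⇒≤length m (removeAll m w) (covers-removeAll m w cov))
                                                   (count>0 w (cov ≤-refl)) ⟩
  length (removeAll m w) + count m w   ∎)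
  where open ≤-Reasoning

top-occurs-once : ∀ m w → length w ≡ suc m → Covers (suc m) w → count m w ≡ 1 × length (removeAll m w) ≡ m
top-occurs-once m w len cov = once , L≡m
  where
  L = length (removeAll m w)
  L+c≡1+m = trans (length-removeAll m w) len
  once = trans (+≡suc⇒≡suc∸ L (count m w) m L+c≡1+m (count>0 w (cov ≤-refl)))
               (cong suc (m≤n⇒m∸n≡0 (covers⇒≤length m (removeAll m w) (covers-removeAll m w cov))))
  L≡m = suc-injective (trans (+-comm 1 L) (trans (cong (L +_) (sym once)) L+c≡1+m))

perm-bounded : ∀ m w → length w ≡ m → Covers m w → All (_< m) w
perm-bounded zero    []  _   _   = []
perm-bounded (suc m) w   len cov = All.tabulate bound
  where
  bounded′ = perm-bounded m (removeAll m w) (proj₂ (top-occurs-once m w len cov)) (covers-removeAll m w cov)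
  bound : ∀ {x} → x ∈ w → x < suc m
  bound {x} x∈ with x ≟ m
  ... | yes refl = ≤-refl
  ... | no  x≢m  = m<n⇒m<1+n (All.lookup bounded′ (∈-removeAll⁺ m w x∈ x≢m))

record Permutation (m : ℕ) (w : List ℕ) : Set where
  field
    length≡ : length w ≡ m
    covers  : Covers m w

  bounded : All (_< m) w
  bounded = perm-bounded m w length≡ covers

isPerm⇒Permutation : ∀ {m} w → T (isPerm m w) → Permutation m w
isPerm⇒Permutation {m} w t = record
  { length≡ = ≡ᵇ⇒≡ (length w) m (T-∧ˡ (length w ≡ᵇ m) t)
  ; covers  = ∈ᵇ⇒∈ w ∘ applyUpTo⁻ id m (all⁺ (λ j → j ∈ᵇ w) (upTo m) (T-∧ʳ (length w ≡ᵇ m) t))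
  }

Permutation⇒isPerm : ∀ {m w} → Permutation m w → T (isPerm m w)
Permutation⇒isPerm {m} {w} π = Equivalence.from T-∧
  (≡⇒≡ᵇ (length w) m length≡ , all⁻ (λ j → j ∈ᵇ w) (applyUpTo⁺₁ id m (∈⇒∈ᵇ ∘ covers)))
  where open Permutation π

countBelow : ℕ → List ℕ → ℕ
countBelow x w = List.sum (map (λ y → if y <ᵇ x then 1 else 0) w)

countBelow-all : ∀ {x} w → All (_< x) w → countBelow x w ≡ length w
countBelow-all []       []          = refl
countBelow-all {x} (y ∷ ys) (y<x ∷ all) rewrite dec-true (y <? x) y<x = cong suc (countBelow-all ys all)

countBelow-insertBlock : ∀ {x m} p w → x < m → countBelow x (insertBlock p 1 m w) ≡ countBelow x w
countBelow-insertBlock {x} {m} zero    w        x<m rewrite dec-false (m <? x) (<⇒≯ x<m) = refl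
countBelow-insertBlock {x} {m} (suc p) []       x<m rewrite dec-false (m <? x) (<⇒≯ x<m) = refl
countBelow-insertBlock {x}     (suc p) (y ∷ ys) x<m = cong ((if y <ᵇ x then 1 else 0) +_) (countBelow-insertBlock p ys x<m)

-- the new maximum forms an inversion with each of the length w ∸ p entries after it
inversions-insertBlock : ∀ {m} p w → All (_< m) w → p ≤ length w →
                         inversions (insertBlock p 1 m w) ≡ inversions w + (length w ∸ p)
inversions-insertBlock zero    w        all          _        =
  trans (cong (_+ inversions w) (countBelow-all w all)) (+-comm (length w) _)
inversions-insertBlock (suc p) (y ∷ ys) (y<m ∷ all) (s≤s p≤) =
  trans (cong₂ _+_ (countBelow-insertBlock p ys y<m) (inversions-insertBlock p ys all p≤))
        (sym (+-assoc (countBelow y ys) _ _))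

module _ {m w′} (π′ : Permutation m w′) (p : ℕ) (p≤m : p ≤ m) where
  open Permutation π′
  private
    w = insertBlock p 1 m w′
    m∉w′ = All<⇒∉ bounded
    p≤length = subst (p ≤_) (sym length≡) p≤m

  permutation-insertTop : Permutation (suc m) w
  permutation-insertTop = record
    { length≡ = trans (length-insertBlock p 1 m w′) (trans (+-comm (length w′) 1) (cong suc length≡))
    ; covers  = λ {j} j<1+m → case j ≟ m of λ where
        (yes refl) → ∈-insertBlock⁺ˡ p 0 m w′
        (no  j≢m)  → ∈-insertBlock⁺ʳ p 1 m w′ (covers (≤∧≢⇒< (≤-pred j<1+m) j≢m))
    }

  inversions-insertTop : inversions w ≡ inversions w′ + (m ∸ p)
  inversions-insertTop =
    trans (inversions-insertBlock p w′ bounded p≤length) (cong (λ L → inversions w′ + (L ∸ p)) length≡)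

  removeAll-insertTop : removeAll m w ≡ w′
  removeAll-insertTop = removeAll-insertBlock p 1 w′ m∉w′

  firstIndex-insertTop : firstIndex m w ≡ p
  firstIndex-insertTop = firstIndex-insertBlock p 0 w′ m∉w′ p≤length

module _ {m w} (π : Permutation (suc m) w) where
  open Permutation π
  private
    w′ = removeAll m w
    once,length′ = top-occurs-once m w length≡ covers

  permutation-removeTop : Permutation m w′
  permutation-removeTop = record
    { length≡ = proj₂ once,length′
    ; covers  = covers-removeAll m w covers
    }

  firstIndex-top≤ : firstIndex m w ≤ m
  firstIndex-top≤ = subst (firstIndex m w ≤_) (proj₂ once,length′) (firstIndex≤length-removeAll m w)

  insertBlock-removeAll-top : w ≡ insertBlock (firstIndex m w) 1 m w′
  insertBlock-removeAll-top = count≡1⇒insertBlock-removeAll m w (proj₁ once,length′)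

  inversions-removeTop : inversions w ≡ inversions w′ + (m ∸ firstIndex m w)
  inversions-removeTop =
    trans (cong inversions insertBlock-removeAll-top)
          (inversions-insertTop permutation-removeTop (firstIndex m w) firstIndex-top≤)

isEven-suc : ∀ n → isEven (suc n) ≡ not (isEven n)
isEven-suc zero          = refl
isEven-suc (suc zero)    = refl
isEven-suc (suc (suc n)) = isEven-suc n

isEven-+ : ∀ a c → isEven (a + c) ≡ (isEven a ==ᴮ isEven c)
isEven-+ zero          c = refl
isEven-+ (suc zero)    c = isEven-suc c
isEven-+ (suc (suc a)) c = isEven-+ a c

==ᴮ-rotate : ∀ a b c → (a ==ᴮ (b ==ᴮ c)) ≡ ((a ==ᴮ c) ==ᴮ b)
==ᴮ-rotate true  true  true  = refl
==ᴮ-rotate true  true  false = refl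
==ᴮ-rotate true  false true  = refl
==ᴮ-rotate true  false false = refl
==ᴮ-rotate false true  true  = refl
==ᴮ-rotate false true  false = refl
==ᴮ-rotate false false true  = refl
==ᴮ-rotate false false false = refl

parity-shift : ∀ b i′ d {i} → i ≡ i′ + d → (b ==ᴮ isEven i) ≡ ((b ==ᴮ isEven d) ==ᴮ isEven i′)
parity-shift b i′ d refl = trans (cong (b ==ᴮ_) (isEven-+ i′ d)) (==ᴮ-rotate b (isEven i′) (isEven d))

PermOfParity : ℕ → Bool → Set
PermOfParity m b = Σ (List ℕ) λ w → T (isPerm m w ∧ (b ==ᴮ isEven (inversions w)))

-- (p, w′) stands for the word obtained by inserting the letter m into w′ at position p, which
-- adds m − p inversions
TopDecomposition : ℕ → Bool → Set
TopDecomposition m b = Σ (Fin (suc m)) λ p → PermOfParity m (b ==ᴮ isEven (m ∸ toℕ p))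

TopDecomposition-≡ : ∀ {m b} {p p′ : Fin (suc m)} {x : PermOfParity m (b ==ᴮ isEven (m ∸ toℕ p))}
                       {x′ : PermOfParity m (b ==ᴮ isEven (m ∸ toℕ p′))} →
                     toℕ p ≡ toℕ p′ → proj₁ x ≡ proj₁ x′ → _≡_ {A = TopDecomposition m b} (p , x) (p′ , x′)
TopDecomposition-≡ {p = p} p≡p′ w≡w′ with toℕ-injective p≡p′
... | refl = cong (p ,_) (subtype-≡ w≡w′)

module _ (m : ℕ) (b : Bool) where

  private
    module Removal (x : PermOfParity (suc m) b) where
      w  = proj₁ x
      π  = isPerm⇒Permutation w (T-∧ˡ (isPerm (suc m) w) (proj₂ x))
      w′ = removeAll m w
      p< : firstIndex m w < suc m
      p< = s≤s (firstIndex-top≤ π)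
      p  = fromℕ< p<
      inversions≡ : inversions w ≡ inversions w′ + (m ∸ toℕ p)
      inversions≡ = trans (inversions-removeTop π) (cong (λ q → inversions w′ + (m ∸ q)) (sym (toℕ-fromℕ< p<)))

    module Insertion (y : TopDecomposition m b) where
      p  = proj₁ y
      w′ = proj₁ (proj₂ y)
      t′ = proj₂ (proj₂ y)
      π′ = isPerm⇒Permutation w′ (T-∧ˡ (isPerm m w′) t′)
      p≤m = ≤-pred (toℕ<n p)
      w  = insertBlock (toℕ p) 1 m w′

  removeTop : PermOfParity (suc m) b → TopDecomposition m b
  removeTop x = p , w′ , Equivalence.from T-∧
    ( Permutation⇒isPerm (permutation-removeTop π)
    , subst T (parity-shift b (inversions w′) (m ∸ toℕ p) inversions≡) (T-∧ʳ (isPerm (suc m) w) (proj₂ x)) )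
    where open Removal x

  insertTop : TopDecomposition m b → PermOfParity (suc m) b
  insertTop y = w , Equivalence.from T-∧
    ( Permutation⇒isPerm (permutation-insertTop π′ (toℕ p) p≤m)
    , subst T (sym (parity-shift b (inversions w′) (m ∸ toℕ p) (inversions-insertTop π′ (toℕ p) p≤m)))
              (T-∧ʳ (isPerm m w′) t′) )
    where open Insertion y

  removeTop-insertTop : ∀ y → removeTop (insertTop y) ≡ y
  removeTop-insertTop y = TopDecomposition-≡ {b = b}
    (trans (toℕ-fromℕ< _) (firstIndex-insertTop π′ (toℕ p) p≤m))
    (removeAll-insertTop π′ (toℕ p) p≤m)
    where open Insertion y

  insertTop-removeTop : ∀ x → insertTop (removeTop x) ≡ x
  insertTop-removeTop x = subtype-≡
    (trans (cong (λ q → insertBlock q 1 m w′) (toℕ-fromℕ< p<)) (sym (insertBlock-removeAll-top π)))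
    where open Removal x

  topDecomposition : PermOfParity (suc m) b ↔ TopDecomposition m b
  topDecomposition = mk↔ₛ′ removeTop insertTop removeTop-insertTop insertTop-removeTop

Σ-Fin-↔ : ∀ {n} {B : Fin n → Set} (c : Fin n → ℕ) → (∀ i → B i ↔ Fin (c i)) → Σ (Fin n) B ↔ Fin (sum c)
Σ-Fin-↔ {zero}      c _  = mk↔ₛ′ (λ { (() , _) }) (λ ()) (λ ()) (λ { (() , _) })
Σ-Fin-↔ {suc n} {B} c B↔ =
  ↔-trans Σ-split (↔-trans (B↔ Fin.zero ⊎-↔ Σ-Fin-↔ (c ∘ Fin.suc) (B↔ ∘ Fin.suc)) (↔-sym +↔⊎))
  where
  Σ-split : Σ (Fin (suc n)) B ↔ (B Fin.zero ⊎ Σ (Fin n) (B ∘ Fin.suc))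
  Σ-split = mk↔ₛ′ (λ { (Fin.zero , b) → inj₁ b ; (Fin.suc i , b) → inj₂ (i , b) })
                  (λ { (inj₁ b) → Fin.zero , b ; (inj₂ (i , b)) → Fin.suc i , b })
                  (λ { (inj₁ _) → refl ; (inj₂ _) → refl })
                  (λ { (Fin.zero , _) → refl ; (Fin.suc _ , _) → refl })

sum-const : ∀ n k → sum {n} (λ _ → k) ≡ n * k
sum-const zero    k = refl
sum-const (suc n) k = cong (k +_) (sum-const n k)

-- the number of even permutations of n + 1 letters, (n + 1)! / 2 for n ≥ 1
altCount : ℕ → ℕ
altCount zero          = 1
altCount (suc zero)    = 1
altCount (suc (suc n)) = (3 + n) * altCount (suc n)

altCount-suc : ∀ n → altCount (suc n) ≡ ∑[ i < suc n ] (suc (toℕ i) * altCount (toℕ i))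
altCount-suc zero    = refl
altCount-suc (suc n) = begin
  altCount (suc (suc n))
    ≡⟨⟩
  altCount (suc n) + f (suc n)
    ≡⟨ cong (_+ f (suc n)) (altCount-suc n) ⟩
  ∑[ i < suc n ] f (toℕ i) + f (suc n)
    ≡⟨ cong₂ _+_ (sum-cong-≗ {suc n} (cong f ∘ toℕ-inject₁)) (cong f (toℕ-fromℕ (suc n))) ⟨
  ∑[ i < suc n ] f (toℕ (inject₁ i)) + f (toℕ (fromℕ (suc n)))
    ≡⟨ sum-init-last {suc n} (f ∘ toℕ) ⟨
  ∑[ i < suc (suc n) ] f (toℕ i) ∎
  where
  open ≡-Reasoning
  f = λ k → suc k * altCount k

Cay212-empty : Cay212 0 ↔ Fin 1
Cay212-empty = mk↔ₛ′ (λ _ → Fin.zero) (λ _ → [] , tt) (λ { Fin.zero → refl ; (Fin.suc ()) }) only-[]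
  where
  only-[] : ∀ x → ([] , tt) ≡ x
  only-[] ([] , tt) = refl

Cay212↔Fin : ∀ n → Cay212 n ↔ Fin (altCount n)
Cay212↔Fin = <-rec (λ n → Cay212 n ↔ Fin (altCount n)) step
  where
  step : ∀ n → (∀ {m} → m < n → Cay212 m ↔ Fin (altCount m)) → Cay212 n ↔ Fin (altCount n)
  step zero    _   = Cay212-empty
  step (suc n) rec = begin
    Cay212 (suc n)                                           ↔⟨ maxDecomposition n ⟩
    MaxDecomposition n                                       ↔⟨ Σ-Fin-↔ _ piece ⟩
    Fin (∑[ i < suc n ] (suc (toℕ i) * altCount (toℕ i)))  ≡⟨ cong Fin (altCount-suc n) ⟨
    Fin (altCount (suc n))                                   ∎
    where
    open Related.EquationalReasoning
    piece : ∀ i → (Fin (suc (toℕ i)) × Cay212 (toℕ i)) ↔ Fin (suc (toℕ i) * altCount (toℕ i))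
    piece i = ↔-trans (↔-refl ×-↔ rec (toℕ<n i)) (↔-sym *↔×)

permCount : ℕ → Bool → ℕ
permCount zero    b = if b then 1 else 0
permCount (suc m) b = ∑[ p < suc m ] permCount m (b ==ᴮ isEven (m ∸ toℕ p))

PermOfParity-empty : ∀ b → PermOfParity 0 b ↔ Fin (permCount 0 b)
PermOfParity-empty true  =
  mk↔ₛ′ (λ _ → Fin.zero) (λ _ → [] , tt) (λ { Fin.zero → refl ; (Fin.suc ()) }) λ { ([] , tt) → refl }
PermOfParity-empty false = mk↔ₛ′ (λ { ([] , ()) }) (λ ()) (λ ()) (λ { ([] , ()) })

PermOfParity↔Fin : ∀ m b → PermOfParity m b ↔ Fin (permCount m b)
PermOfParity↔Fin zero    b = PermOfParity-empty b
PermOfParity↔Fin (suc m) b =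
  ↔-trans (topDecomposition m b) (Σ-Fin-↔ (permCount m ∘ parity) (PermOfParity↔Fin m ∘ parity))
  where parity = λ (p : Fin (suc m)) → b ==ᴮ isEven (m ∸ toℕ p)

-- from two letters on, both parity classes have the same size
permCount-2+ : ∀ n b → permCount (2 + n) b ≡ altCount (1 + n)
permCount-2+ zero    true  = refl
permCount-2+ zero    false = refl
permCount-2+ (suc n) b     =
  trans (sum-cong-≗ {3 + n} λ p → permCount-2+ n (b ==ᴮ isEven ((2 + n) ∸ toℕ p)))
        (sum-const (3 + n) (altCount (1 + n)))

Alt′↔Fin : ∀ n → Alt′ n ↔ Fin (altCount n)
Alt′↔Fin zero    = PermOfParity↔Fin 1 true
Alt′↔Fin (suc n) = subst (λ k → Alt′ (suc n) ↔ Fin k) (permCount-2+ n true) (PermOfParity↔Fin (2 + n) true)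

theorem6p6 : (n : ℕ) → CayAvoid p212 n ↔ Alt′ n
theorem6p6 n = begin
  CayAvoid p212 n   ↔⟨ Cay212↔Fin n ⟩
  Fin (altCount n)  ↔⟨ Alt′↔Fin n ⟨
  Alt′ n            ∎
  where open Related.EquationalReasoning
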